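{- There is an algorithm which, given an integer $n \ge 2$, outputs the bits of the string $S_n$ in order, using $O(n)$ space (a constant number of arrays with $O(n)$ entries, each entry an integer of absolute value at most $n+1$) and performing only a constant number of elementary operations (comparisons, increments, decrements, parity tests) on such integers between consecutive output bits (i.e., the algorithm is loopless).
   Context: Binary strings $S_n$ of length $n!$ are defined recursively: $S_2 = 00$, and for $n \ge 2$, if $S_n = x_1 x_2 \cdots x_{n!}$ then $S_{n+1} = 0\,0\,1^{n-2}\,\overline{x}_1\; 0\,0\,1^{n-2}\,\overline{x}_2 \cdots 0\,0\,1^{n-2}\,\overline{x}_{n!}$, where $\overline{x}$ is the complement of the bit $x$, $1^{m}$ denotes $m$ copies of $1$ and $1^0$ is empty. -}

module Defs where

open import Data.Nat as ℕ using (ℕ; zero; suc; _≤_; _<_)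
open import Data.Integer as ℤ using (ℤ; +_; -[1+_]; ∣_∣)
open import Data.Bool using (Bool; true; false; not; if_then_else_)
open import Data.Fin as Fin using (Fin)
open import Data.Vec as Vec using (Vec)
open import Data.List as List using (List; []; _∷_; _++_; replicate; concatMap)
open import Data.Maybe as Maybe using (Maybe; just; nothing; _>>=_)
open import Data.Product using (_×_; _,_)
open import Relation.Nullary using (yes; no)
open import Relation.Binary.PropositionalEquality using (_≡_; refl)
open import Data.List.Relation.Unary.All using (All)
open import Data.Product using (Σ)

-- The strings S_n (bits as Bool: false = 0, true = 1).
-- S 0 and S 1 are irrelevant (set to []); S 2 = 00 and
-- S (n+1) = 0 0 1^(n-2) ~x1  0 0 1^(n-2) ~x2 ...  for n ≥ 2.

S : ℕ → List Bool
S zero = []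
S (suc zero) = []
S (suc (suc zero)) = false ∷ false ∷ []
S (suc (suc (suc m))) =
  concatMap (λ x → false ∷ false ∷ (replicate m true ++ (not x ∷ [])))
            (S (suc (suc m)))

-- Memory: K arrays (K a constant), array k having length mult k * n + add k
-- (O(n) entries), each entry an integer of absolute value ≤ n + 1.

record Shape : Set where
  field
    K    : ℕ
    mult : Fin K → ℕ
    add  : Fin K → ℕ
open Shape public

len : (sh : Shape) → Fin (K sh) → ℕ → ℕ
len sh k n = mult sh k ℕ.* n ℕ.+ add sh k

Memory : Shape → ℕ → Set
Memory sh n = (k : Fin (K sh)) → Vec ℤ (len sh k n)

Bounded : (sh : Shape) (n : ℕ) → Memory sh n → Set
Bounded sh n σ = ∀ k i → ∣ Vec.lookup (σ k) i ∣ ≤ suc n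

data Expr (K : ℕ) : Set where
  lit : ℤ → Expr K
  rd  : Fin K → Expr K → Expr K

-- Statements: assignment, increment, decrement, comparisons (<, =),
-- parity test, output of a bit, halting.  Conditionals nest, but a
-- program is a finite piece of loop-free code.
data Stmt (K : ℕ) : Set where
  set    : Fin K → Expr K → Expr K → Stmt K
  inc    : Fin K → Expr K → Stmt K
  dec    : Fin K → Expr K → Stmt K
  ifLess : Expr K → Expr K → List (Stmt K) → List (Stmt K) → Stmt K
  ifEq   : Expr K → Expr K → List (Stmt K) → List (Stmt K) → Stmt K
  ifEven : Expr K → List (Stmt K) → List (Stmt K) → Stmt K
  out    : Bool → Stmt K
  halt   : Stmt K

Program : Shape → Set
Program sh = List (Stmt (K sh))

record Config (sh : Shape) (n : ℕ) : Set where
  constructor config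
  field
    mem    : Memory sh n
    outs   : List Bool
    halted : Bool
open Config public

module Semantics (sh : Shape) (n : ℕ) where

  toIdx : (m : ℕ) → ℤ → Maybe (Fin m)
  toIdx m (+ i) with i ℕ.<? m
  ... | yes p = just (Fin.fromℕ< p)
  ... | no _  = nothing
  toIdx m -[1+ _ ] = nothing

  eval : Expr (K sh) → Memory sh n → Maybe ℤ
  eval (lit z) σ = just z
  eval (rd k e) σ =
    eval e σ >>= λ i → toIdx (len sh k n) i >>= λ f → just (Vec.lookup (σ k) f)

  upd : Memory sh n → (k : Fin (K sh)) → Fin (len sh k n) → ℤ → Memory sh n
  upd σ k i v k' with k Fin.≟ k'
  ... | yes refl = Vec.updateAt (σ k) i (λ _ → v)
  ... | no _     = σ k'

  -- writing a value of absolute value > n + 1, or out of range, fails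
  write : Memory sh n → Fin (K sh) → ℤ → ℤ → Maybe (Memory sh n)
  write σ k i v with ∣ v ∣ ℕ.≤? suc n | toIdx (len sh k n) i
  ... | yes _ | just f  = just (upd σ k f v)
  ... | yes _ | nothing = nothing
  ... | no _  | _       = nothing

  even? : ℤ → Bool
  even? z with ∣ z ∣ ℕ.% 2 ℕ.≟ 0
  ... | yes _ = true
  ... | no _  = false

  less? : ℤ → ℤ → Bool
  less? a b with a ℤ.<? b
  ... | yes _ = true
  ... | no _  = false

  eq? : ℤ → ℤ → Bool
  eq? a b with a ℤ.≟ b
  ... | yes _ = true
  ... | no _  = false

  withMem : Config sh n → Memory sh n → Config sh n
  withMem c σ = config σ (outs c) (halted c)

  mutual
    exec : Stmt (K sh) → Config sh n → Maybe (Config sh n)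
    exec (set k e₁ e₂) c =
      eval e₁ (mem c) >>= λ i → eval e₂ (mem c) >>= λ v →
      write (mem c) k i v >>= λ σ → just (withMem c σ)
    exec (inc k e) c =
      eval e (mem c) >>= λ i → eval (rd k (lit i)) (mem c) >>= λ v →
      write (mem c) k i (v ℤ.+ ℤ.1ℤ) >>= λ σ → just (withMem c σ)
    exec (dec k e) c =
      eval e (mem c) >>= λ i → eval (rd k (lit i)) (mem c) >>= λ v →
      write (mem c) k i (v ℤ.- ℤ.1ℤ) >>= λ σ → just (withMem c σ)
    exec (ifLess a b t e) c =
      eval a (mem c) >>= λ x → eval b (mem c) >>= λ y →
      if less? x y then execList t c else execList e c
    exec (ifEq a b t e) c =
      eval a (mem c) >>= λ x → eval b (mem c) >>= λ y →
      if eq? x y then execList t c else execList e c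
    exec (ifEven a t e) c =
      eval a (mem c) >>= λ x →
      if even? x then execList t c else execList e c
    exec (out b) c = just (config (mem c) (outs c ++ (b ∷ [])) (halted c))
    exec halt c = just (config (mem c) (outs c) true)

    execList : List (Stmt (K sh)) → Config sh n → Maybe (Config sh n)
    execList [] c = just c
    execList (s ∷ ss) c =
      if halted c then just c else (exec s c >>= execList ss)

  step : Program sh → Memory sh n → Maybe (Config sh n)
  step P σ = execList P (config σ [] false)

  -- Failure (bad access, bound violation,
  -- not halting within fuel) gives nothing.
  run : ℕ → Program sh → Memory sh n → Maybe (List (List Bool) × List Bool)
  run zero P σ = nothing
  run (suc fuel) P σ with step P σ
  ... | nothing = nothing
  ... | just c with halted c
  ...   | true  = just ([] , outs c)
  ...   | false = Maybe.map (λ { (xs , l) → (outs c ∷ xs , l) }) (run fuel P (mem c))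

open Semantics public using (run)

data NonEmpty {A : Set} : List A → Set where
  nonEmpty : ∀ x xs → NonEmpty (x ∷ xs)

-- S n is produced by levels 0, …, n−1 with Bitner–Ehrlich–Reingold focus pointers.  Level s < n−1 owns a
-- counter and emits the bits 0 0 1 … 1 that precede the last bit of each block of S (n−s), complemented when s
-- is odd; when its counter wraps, that last bit is the next bit of level s+1, and the pointer update
-- f s := f (s+1), f (s+1) := s+1 hands the focus there in constant time (f 0 is the level that emits next).
-- Since S (k+1) consists of the blocks 0 0 1 … 1 x̄ for the bits x of S k, induction on n−s shows that level s
-- emits S (n−s) complemented by the parity of s, level n−1 emitting only the final bit.  One iteration of the
-- loop body performs one such step with a constant number of array operations on entries at most n+1.

module Submission where

open import Data.Bool using (Bool; true; false; not; _xor_; if_then_else_)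
open import Data.Bool.Properties
  using (if-cong; not-involutive; xor-identityʳ; not-distribˡ-xor; not-distribʳ-xor)
open import Data.Fin as Fin using (Fin; toℕ; fromℕ<)
open import Data.Fin.Properties using (toℕ-fromℕ<; toℕ-injective; toℕ<n)
open import Data.Integer as ℤ using (+_)
open import Data.List using (List; []; _∷_; _++_; [_]; concat; concatMap; length; map; replicate)
open import Data.List.Properties
  using (map-++; map-id; concatMap-map; map-concatMap; concatMap-cong; ++-assoc; ++-identityʳ)
open import Data.List.Relation.Unary.All using (All; []; _∷_)
open import Data.Maybe using (Maybe; just; _>>=_)
open import Data.Nat using (ℕ; zero; suc; _+_; _∸_; _⊓_; _≤_; _<_; _≤ᵇ_; _%_; _≟_; _<?_; _≤?_; s≤s; s≤s⁻¹; z≤n)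
open import Data.Nat.Properties
  using ( ≤-refl; ≤-trans; ≤-reflexive; <⇒≤; n≤1+n; m≤n⇒m≤1+n; <⇒≢; <⇒≱; ≤∧≢⇒<; 1+n≢n; 1+n≢0; m≢1+n+m
        ; m+n∸n≡m; m∸n≤m; ∸-+-assoc; m<n⇒0<n∸m; m≤n⇒m⊓n≡m; m⊓n≤n; +-identityʳ; +-suc; +-comm; *-identityˡ)
open import Data.Product using (Σ; _×_; _,_; proj₁; proj₂; ∃-syntax)
open import Data.Vec using (lookup; tabulate)
open import Data.Vec.Properties using (lookup∘updateAt; lookup∘updateAt′; lookup∘tabulate)
open import Function using (_∘_; flip)
open import Relation.Nullary using (yes; no; contradiction)
open import Relation.Binary.PropositionalEquality hiding ([_])

open import Defs

-- Pointwise updates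

infixl 6 _[_≔_]
_[_≔_] : (ℕ → ℕ) → ℕ → ℕ → ℕ → ℕ
(g [ i ≔ v ]) k with k ≟ i
... | yes _ = v
... | no _  = g k

update-updates : ∀ g i v → (g [ i ≔ v ]) i ≡ v
update-updates g i v with i ≟ i
... | yes _   = refl
... | no i≢i = contradiction refl i≢i

update-minimal : ∀ g {i k} v → k ≢ i → (g [ i ≔ v ]) k ≡ g k
update-minimal g {i} {k} v k≢i with k ≟ i
... | yes k≡i = contradiction k≡i k≢i
... | no _    = refl

update-cong : ∀ {g h} i {v w} → g ≗ h → v ≡ w → g [ i ≔ v ] ≗ h [ i ≔ w ]
update-cong i g≗h v≡w k with k ≟ i
... | yes _ = v≡w
... | no _  = g≗h k

update-update : ∀ g i v w → g [ i ≔ v ] [ i ≔ w ] ≗ g [ i ≔ w ]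
update-update g i v w k with k ≟ i
... | yes _   = refl
... | no k≢i = update-minimal g v k≢i

update-id-local : ∀ g {i v} → g i ≡ v → g [ i ≔ v ] ≗ g
update-id-local g {i} gi≡v k with k ≟ i
... | yes refl = sym gi≡v
... | no _     = refl

update-preserves : ∀ (Q : ℕ → ℕ → Set) {g i v} →
                   (∀ k → Q k (g k)) → Q i v → ∀ k → Q k ((g [ i ≔ v ]) k)
update-preserves Q {i = i} Qg Qv k with k ≟ i
... | yes refl = Qv
... | no _     = Qg k

-- The strings S n as interleaved levels

odd : ℕ → Bool
odd zero    = false
odd (suc k) = not (odd k)

ownBits : Bool → ℕ → ℕ → List Bool
ownBits p i zero    = []
ownBits p i (suc r) = (p xor (2 ≤ᵇ i)) ∷ ownBits p (suc i) r

ownBits-from2 : ∀ p i m → ownBits p (2 + i) m ≡ map (p xor_) (replicate m true)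
ownBits-from2 p i zero    = refl
ownBits-from2 p i (suc m) = cong ((p xor true) ∷_) (ownBits-from2 p (suc i) m)

xor-S-suc : ∀ p m →
  concatMap (λ b → ownBits p 0 (2 + m) ++ [ b ]) (map (not p xor_) (S (2 + m)))
  ≡ map (p xor_) (S (3 + m))
xor-S-suc p m = begin
  concatMap (λ b → ownBits p 0 (2 + m) ++ [ b ]) (map (not p xor_) (S (2 + m)))
    ≡⟨ concatMap-map _ _ (S (2 + m)) ⟩
  concatMap (λ x → ownBits p 0 (2 + m) ++ [ not p xor x ]) (S (2 + m))
    ≡⟨ concatMap-cong block (S (2 + m)) ⟩
  concatMap (map (p xor_) ∘ S-block) (S (2 + m))
    ≡⟨ map-concatMap (p xor_) S-block (S (2 + m)) ⟨
  map (p xor_) (S (3 + m)) ∎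
  where
  open ≡-Reasoning
  S-block : Bool → List Bool
  S-block x = false ∷ false ∷ (replicate m true ++ [ not x ])
  block : ∀ x → ownBits p 0 (2 + m) ++ [ not p xor x ] ≡ map (p xor_) (S-block x)
  block x = cong (λ t → (p xor false) ∷ (p xor false) ∷ t) (begin
    ownBits p 2 m ++ [ not p xor x ]
      ≡⟨ cong₂ (λ t b → t ++ [ b ]) (ownBits-from2 p 0 m)
               (trans (sym (not-distribˡ-xor p x)) (not-distribʳ-xor p x)) ⟩
    map (p xor_) (replicate m true) ++ map (p xor_) [ not x ]
      ≡⟨ map-++ (p xor_) (replicate m true) [ not x ] ⟨
    map (p xor_) (replicate m true ++ [ not x ]) ∎)

module Levels (n : ℕ) where

  record State : Set where
    constructor ⟨_,_⟩
    field
      focus   : ℕ → ℕ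
      counter : ℕ → ℕ
  open State public

  infix 4 _≈_
  _≈_ : State → State → Set
  σ ≈ τ = focus σ ≗ focus τ × counter σ ≗ counter τ

  ≈-sym : ∀ {σ τ} → σ ≈ τ → τ ≈ σ
  ≈-sym (f≗ , c≗) = sym ∘ f≗ , sym ∘ c≗

  ≈-trans : ∀ {σ τ υ} → σ ≈ τ → τ ≈ υ → σ ≈ υ
  ≈-trans (f≗ , c≗) (f≗′ , c≗′) = (λ k → trans (f≗ k) (f≗′ k)) ,
                                  (λ k → trans (c≗ k) (c≗′ k))

  ≡⇒≈ : ∀ {σ τ} → σ ≡ τ → σ ≈ τ
  ≡⇒≈ refl = (λ _ → refl) , (λ _ → refl)

  -- Within a block of S (n ∸ j), level j < last emits one bit for each counter value 0, …, bound j ∸ 1.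
  last : ℕ
  last = n ∸ 1

  bound : ℕ → ℕ
  bound j = n ∸ suc j

  initial : State
  initial = ⟨ (λ k → k) , (λ _ → 0) ⟩

  reset : ℕ → State → State
  reset s σ = ⟨ focus σ [ s ≔ s ] , counter σ ⟩

  carry : ℕ → State → State
  carry j σ = ⟨ focus σ [ j ≔ focus σ (suc j) ] [ suc j ≔ suc j ] , counter σ [ j ≔ 0 ] ⟩

  advance : ℕ → State → State
  advance j σ with suc (counter σ j) ≟ bound j
  ... | yes _ = carry j σ
  ... | no _  = ⟨ focus σ , counter σ [ j ≔ suc (counter σ j) ] ⟩

  advance-carry : ∀ {j} σ → suc (counter σ j) ≡ bound j → advance j σ ≡ carry j σ
  advance-carry {j} σ wraps with suc (counter σ j) ≟ bound j
  ... | yes _       = refl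
  ... | no ¬wraps = contradiction wraps ¬wraps

  advance-count : ∀ {j} σ → suc (counter σ j) ≢ bound j →
                  advance j σ ≡ ⟨ focus σ , counter σ [ j ≔ suc (counter σ j) ] ⟩
  advance-count {j} σ ¬wraps with suc (counter σ j) ≟ bound j
  ... | yes wraps = contradiction wraps ¬wraps
  ... | no _      = refl

  reset-id : ∀ {s σ} → focus σ s ≡ s → reset s σ ≈ σ
  reset-id {σ = σ} fs = update-id-local (focus σ) fs , λ _ → refl

  reset-cong : ∀ s {σ τ} → σ ≈ τ → reset s σ ≈ reset s τ
  reset-cong s (f≗ , c≗) = update-cong s f≗ refl , c≗

  carry-cong : ∀ j {σ τ} → σ ≈ τ → carry j σ ≈ carry j τ
  carry-cong j (f≗ , c≗) =
    update-cong (suc j) (update-cong j f≗ (f≗ (suc j))) refl , update-cong j c≗ refl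

  advance-cong : ∀ j {σ τ} → σ ≈ τ → advance j σ ≈ advance j τ
  advance-cong j {σ} {τ} σ≈τ@(f≗ , c≗)
    with suc (counter σ j) ≟ bound j | suc (counter τ j) ≟ bound j
  ... | yes _     | yes _     = carry-cong j σ≈τ
  ... | no _      | no _      = f≗ , update-cong j c≗ (cong suc (c≗ j))
  ... | yes wraps | no ¬wraps = contradiction (trans (cong suc (sym (c≗ j))) wraps) ¬wraps
  ... | no ¬wraps | yes wraps = contradiction (trans (cong suc (c≗ j)) wraps) ¬wraps

  carry-focus : ∀ s σ → focus (carry s σ) s ≡ focus σ (suc s)
  carry-focus s σ = trans (update-minimal (focus σ [ s ≔ _ ]) {suc s} {s} _ (1+n≢n ∘ sym))
                          (update-updates (focus σ) s _)

  advance-frame : ∀ {j s} σ → s ≢ j → s ≢ suc j →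
                  focus (advance j σ) s ≡ focus σ s × counter (advance j σ) s ≡ counter σ s
  advance-frame {j} σ s≢j s≢1+j with suc (counter σ j) ≟ bound j
  ... | yes _ = trans (update-minimal _ _ s≢1+j) (update-minimal _ _ s≢j) ,
                update-minimal _ _ s≢j
  ... | no _  = refl , update-minimal _ _ s≢j

  reset-carry : ∀ {s} σ → focus σ s ≡ s → counter σ s ≡ 0 → reset s (carry s σ) ≈ reset (suc s) σ
  reset-carry {s} σ fs cs = focus≗ , update-id-local (counter σ) cs
    where
    f : ℕ → ℕ
    f = focus σ
    focus≗ : focus (reset s (carry s σ)) ≗ f [ suc s ≔ suc s ]
    focus≗ k with k ≟ s | k ≟ suc s
    ... | yes refl | yes k≡1+k = contradiction (sym k≡1+k) 1+n≢n
    ... | yes refl | no _      = sym fs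
    ... | no _     | yes refl  = update-updates _ (suc s) (suc s)
    ... | no k≢s   | no k≢1+s  = trans (update-minimal _ _ k≢1+s) (update-minimal f _ k≢s)

  bit : ℕ → State → Bool
  bit j σ = odd j xor (2 ≤ᵇ counter σ j)

  finalBit : Bool
  finalBit = not (odd last)

  -- The output of the machine started in σ in which every step first resets the focus of level s (level 0 is the
  -- actual loop), up to and including the final bit.
  data Emits (s : ℕ) : State → List Bool → Set where
    halts : ∀ {σ} → focus σ s ≡ last → Emits s σ [ finalBit ]
    steps : ∀ {σ τ j b bs} → focus σ s ≡ j → j ≢ last → bit j σ ≡ b →
           advance j (reset s σ) ≈ τ → Emits s τ bs → Emits s σ (b ∷ bs)

  Emits-resp : ∀ {s σ τ bs} → σ ≈ τ → Emits s σ bs → Emits s τ bs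
  Emits-resp {s} (f≗ , _) (halts fs) = halts (trans (sym (f≗ s)) fs)
  Emits-resp {s} {σ} {τ} σ≈τ@(f≗ , c≗) (steps {j = j} fs j≢L bj adv e) =
    steps (trans (sym (f≗ s)) fs) j≢L (trans (cong (λ c → odd j xor (2 ≤ᵇ c)) (sym (c≗ j))) bj)
          (≈-trans (advance-cong j (reset-cong s (≈-sym σ≈τ))) adv) e

  Upward : State → Set
  Upward σ = ∀ k → k ≤ focus σ k

  Upward-resp : ∀ {σ τ} → σ ≈ τ → Upward σ → Upward τ
  Upward-resp (f≗ , _) up k = subst (k ≤_) (f≗ k) (up k)

  Upward-reset : ∀ s {σ} → Upward σ → Upward (reset s σ)
  Upward-reset s up = update-preserves _≤_ up ≤-refl

  Upward-advance : ∀ j σ → Upward σ → Upward (advance j σ)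
  Upward-advance j σ up with suc (counter σ j) ≟ bound j
  ... | yes _ =
    update-preserves _≤_ (update-preserves _≤_ up (≤-trans (n≤1+n j) (up (suc j)))) ≤-refl
  ... | no _  = up

  emits-ownBits : ∀ s r i {σ rest} → s ≢ last → focus σ s ≡ s → counter σ s ≡ i →
                  r + suc i ≡ bound s →
                  Emits s (carry s σ) rest → Emits s σ (ownBits (odd s) i (suc r) ++ rest)
  emits-ownBits s zero i {σ} s≢L fs cs wraps e =
    steps fs s≢L (cong (λ c → odd s xor (2 ≤ᵇ c)) cs) carried e
    where
    carried : advance s (reset s σ) ≈ carry s σ
    carried = ≈-trans (≡⇒≈ (advance-carry (reset s σ) (trans (cong suc cs) wraps)))
                      (carry-cong s (reset-id fs))
  emits-ownBits s (suc r) i {σ} s≢L fs cs wraps e =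
    steps fs s≢L (cong (λ c → odd s xor (2 ≤ᵇ c)) cs) (≡⇒≈ (advance-count (reset s σ) ¬wraps))
      (emits-ownBits s r (suc i) s≢L (update-updates (focus σ) s s)
         (trans (update-updates (counter σ) s _) (cong suc cs)) (trans (+-suc r (suc i)) wraps)
         (Emits-resp carried e))
    where
    ¬wraps : suc (counter σ s) ≢ bound s
    ¬wraps eq = m≢1+n+m (suc i) (trans (cong suc (sym cs)) (trans eq (sym wraps)))
    carried : carry s σ ≈ carry s ⟨ focus σ [ s ≔ s ] , counter σ [ s ≔ suc (counter σ s) ] ⟩
    carried = proj₁ (carry-cong s {σ} (≈-sym (reset-id fs))) ,
              sym ∘ update-update (counter σ) s _ 0

  -- A carry at level s moves the focus to level s+1 just as a step of level s+1 would (reset-carry), so level s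
  -- interleaves blocks of its own bits with the bits of level s+1.
  emits-lift : ∀ s r {σ bs} → s ≢ last → suc r ≡ bound s → Upward σ →
               focus σ s ≡ s → counter σ s ≡ 0 → Emits (suc s) σ bs →
               Emits s σ (concatMap (λ b → ownBits (odd s) 0 (suc r) ++ [ b ]) bs)
  emits-lift s r {σ} s≢L r+1≡b up fs cs (halts fs′) =
    subst (Emits s σ) (sym (++-identityʳ _))
      (emits-ownBits s r 0 s≢L fs cs (trans (+-comm r 1) r+1≡b)
        (halts (trans (carry-focus s σ) fs′)))
  emits-lift s r {σ} s≢L r+1≡b up fs cs (steps {τ = τ} {j} {b} {bs} fj j≢L bj adv e) =
    subst (Emits s σ) (sym (++-assoc own [ b ] _))
      (emits-ownBits s r 0 s≢L fs cs (trans (+-comm r 1) r+1≡b)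
        (steps (trans (carry-focus s σ) fj) j≢L
              (trans (cong (λ c → odd j xor (2 ≤ᵇ c)) (update-minimal (counter σ) 0 j≢s)) bj)
              (≈-trans (advance-cong j (reset-carry σ fs cs)) adv)
              (emits-lift s r s≢L r+1≡b upτ (trans (sym (proj₁ adv s)) fτ)
                                            (trans (sym (proj₂ adv s)) cτ) e)))
    where
    own : List Bool
    own = ownBits (odd s) 0 (suc r)
    s<j : s < j
    s<j = subst (suc s ≤_) fj (up (suc s))
    j≢s : j ≢ s
    j≢s = ≢-sym (<⇒≢ s<j)
    frame : focus (advance j (reset (suc s) σ)) s ≡ focus (reset (suc s) σ) s ×
            counter (advance j (reset (suc s) σ)) s ≡ counter σ s
    frame = advance-frame (reset (suc s) σ) (<⇒≢ s<j) (<⇒≢ (≤-trans s<j (n≤1+n j)))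
    fτ : focus (advance j (reset (suc s) σ)) s ≡ s
    fτ = trans (proj₁ frame) (trans (update-minimal (focus σ) {suc s} _ (1+n≢n ∘ sym)) fs)
    cτ : counter (advance j (reset (suc s) σ)) s ≡ 0
    cτ = trans (proj₂ frame) cs
    upτ : Upward τ
    upτ = Upward-resp adv (Upward-advance j _ (Upward-reset (suc s) {σ} up))

  last≡ : ∀ k s → suc k + s ≡ n → last ≡ k + s
  last≡ k s refl = refl

  below-last : ∀ k s → suc (suc k) + s ≡ n → s ≢ last
  below-last k s k+s≡n = m≢1+n+m s ∘ flip trans (last≡ (suc k) s k+s≡n)

  bound≡ : ∀ k s → suc k + s ≡ n → bound s ≡ k
  bound≡ k s refl = m+n∸n≡m k s

  emits-xor-S : ∀ k s → k + s ≡ n → 2 ≤ k → Emits s initial (map (odd s xor_) (S k))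
  emits-xor-S (suc zero) s _ (s≤s ())
  emits-xor-S (suc (suc zero)) s k+s≡n _ =
    subst (λ b → Emits s initial ((odd s xor false) ∷ b ∷ [])) finalBit≡
      (emits-ownBits s 0 0 (below-last 0 s k+s≡n) refl refl (sym (bound≡ _ s k+s≡n))
        (halts (trans (carry-focus s initial) (sym (last≡ _ s k+s≡n)))))
    where
    finalBit≡ : finalBit ≡ odd s xor false
    finalBit≡ = trans (cong (not ∘ odd) (last≡ _ s k+s≡n))
                      (trans (not-involutive (odd s)) (sym (xor-identityʳ (odd s))))
  emits-xor-S (suc (suc (suc m))) s k+s≡n _ =
    subst (Emits s initial) (xor-S-suc (odd s) m)
      (emits-lift s (suc m) (below-last (suc m) s k+s≡n) (sym (bound≡ _ s k+s≡n))
                  (λ _ → ≤-refl) refl refl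
        (emits-xor-S (suc (suc m)) (suc s) (trans (+-suc (suc (suc m)) s) k+s≡n) (s≤s (s≤s z≤n))))

  emits-S : 2 ≤ n → Emits 0 initial (S n)
  emits-S 2≤n = subst (Emits 0 initial) (map-id (S n)) (emits-xor-S n 0 (+-identityʳ n) 2≤n)

  InRange : State → Set
  InRange σ = (∀ k → k ≤ last → focus σ k ≤ last) × (∀ k → k < last → counter σ k < bound k)

  InRange-resp : ∀ {σ τ} → σ ≈ τ → InRange σ → InRange τ
  InRange-resp (f≗ , c≗) (fr , cr) =
    (λ k k≤L → subst (_≤ last) (f≗ k) (fr k k≤L)) ,
    (λ k k<L → subst (_< bound k) (c≗ k) (cr k k<L))

  InRange-reset : ∀ σ → InRange σ → InRange (reset 0 σ)
  InRange-reset σ (fr , cr) = update-preserves (λ k x → k ≤ last → x ≤ last) fr (λ _ → z≤n) , cr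

  InRange-advance : ∀ j σ → j < last → InRange σ → InRange (advance j σ)
  InRange-advance j σ j<L (fr , cr) with suc (counter σ j) ≟ bound j
  ... | yes _ =
    update-preserves (λ k x → k ≤ last → x ≤ last)
      (update-preserves (λ k x → k ≤ last → x ≤ last) fr (λ _ → fr (suc j) j<L)) (λ _ → j<L) ,
    update-preserves (λ k x → k < last → x < bound k) cr (λ _ → ≤-trans (s≤s z≤n) (cr j j<L))
  ... | no ¬wraps =
    fr , update-preserves (λ k x → k < last → x < bound k) cr (λ _ → ≤∧≢⇒< (cr j j<L) ¬wraps)

-- A program logic for the machine model

>>=-just : ∀ {A B : Set} {m : Maybe A} {x : A} (f : A → Maybe B) → m ≡ just x → (m >>= f) ≡ f x
>>=-just f refl = refl

module Hoare (sh : Shape) (n : ℕ) where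
  open Semantics sh n hiding (run)

  Arrays : Set
  Arrays = Fin (K sh) → ℕ → ℕ

  infix 4 _≋_
  _≋_ : Arrays → Arrays → Set
  A ≋ B = ∀ k → A k ≗ B k

  _⟦_,_≔_⟧ : Arrays → Fin (K sh) → ℕ → ℕ → Arrays
  (A ⟦ k , i ≔ v ⟧) k′ with k Fin.≟ k′
  ... | yes refl = A k [ i ≔ v ]
  ... | no _     = A k′

  -- Records rather than type synonyms, so that arrays, expressions and memories are inferred from the types.
  record Represents (A : Arrays) (mem : Memory sh n) : Set where
    constructor represents
    field lookup≡ : ∀ k i → lookup (mem k) i ≡ + A k (toℕ i)
  open Represents

  Represents-resp : ∀ {A B mem} → A ≋ B → Represents A mem → Represents B mem
  Represents-resp A≋B rep = represents λ k i → trans (lookup≡ rep k i) (cong +_ (A≋B k (toℕ i)))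

  toIdx-< : ∀ {m i} (p : i < m) → toIdx m (+ i) ≡ just (fromℕ< p)
  toIdx-< {m} {i} p with i <? m
  ... | yes _  = refl
  ... | no i≮m = contradiction p i≮m

  write-< : ∀ mem k {i v} → v ≤ suc n → (p : i < len sh k n) →
            write mem k (+ i) (+ v) ≡ just (upd mem k (fromℕ< p) (+ v))
  write-< mem k {i} {v} v≤ p with v ≤? suc n | toIdx (len sh k n) (+ i) | toIdx-< {len sh k n} p
  ... | yes _  | _ | refl = refl
  ... | no v≰ | _ | _    = contradiction v≤ v≰

  Represents-upd : ∀ {A mem k i} v → Represents A mem → (p : i < len sh k n) →
                   Represents (A ⟦ k , i ≔ v ⟧) (upd mem k (fromℕ< p) (+ v))
  Represents-upd {A} {mem} {k} {i} v rep p = represents updated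
    where
    updated : ∀ k′ x → lookup (upd mem k (fromℕ< p) (+ v) k′) x ≡ + (A ⟦ k , i ≔ v ⟧) k′ (toℕ x)
    updated k′ x with k Fin.≟ k′
    ... | no _ = lookup≡ rep k′ x
    ... | yes refl with x Fin.≟ fromℕ< p
    ...   | yes refl = trans (lookup∘updateAt (fromℕ< p) (mem k))
                             (cong +_ (sym (trans (cong (A k [ i ≔ v ]) (toℕ-fromℕ< p))
                                                  (update-updates (A k) i v))))
    ...   | no x≢p   = trans (lookup∘updateAt′ x (fromℕ< p) x≢p (mem k))
                             (trans (lookup≡ rep k x) (cong +_ (sym (update-minimal (A k) v toℕx≢i))))
      where
      toℕx≢i : toℕ x ≢ i
      toℕx≢i eq = x≢p (toℕ-injective (trans eq (sym (toℕ-fromℕ< p))))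

  infix 4 _⊢_⇓_
  record _⊢_⇓_ (A : Arrays) (e : Expr (K sh)) (v : ℕ) : Set where
    constructor evals
    field eval≡ : ∀ {mem} → Represents A mem → eval e mem ≡ just (+ v)
  open _⊢_⇓_

  lit⇓ : ∀ {A} v → A ⊢ lit (+ v) ⇓ v
  lit⇓ v = evals λ _ → refl

  rd⇓ : ∀ {A e i} k → i < len sh k n → A ⊢ e ⇓ i → A ⊢ rd k e ⇓ A k i
  rd⇓ {A} k p e⇓ = evals λ rep →
    trans (>>=-just _ (eval≡ e⇓ rep)) (trans (>>=-just _ (toIdx-< p))
      (cong just (trans (lookup≡ rep k (fromℕ< p)) (cong (+_ ∘ A k) (toℕ-fromℕ< p)))))

  ⇓-≡ : ∀ {A e v w} → A ⊢ e ⇓ v → v ≡ w → A ⊢ e ⇓ w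
  ⇓-≡ e⇓ refl = e⇓

  record Exec (A : Arrays) (o : List Bool) (s : Stmt (K sh))
              (B : Arrays) (o′ : List Bool) (h : Bool) : Set where
    constructor execs
    field exec⇒ : ∀ {mem} → Represents A mem →
                  ∃[ mem′ ] exec s (config mem o false) ≡ just (config mem′ o′ h) × Represents B mem′
  open Exec

  record Runs (A : Arrays) (o : List Bool) (ss : List (Stmt (K sh)))
              (B : Arrays) (o′ : List Bool) (h : Bool) : Set where
    constructor runs
    field execList⇒ : ∀ {mem} → Represents A mem →
                      ∃[ mem′ ] execList ss (config mem o false) ≡ just (config mem′ o′ h) ×
                                Represents B mem′
  open Runs public

  exec-set : ∀ {A o e₁ e₂ i v} k → i < len sh k n → v ≤ suc n →
             A ⊢ e₁ ⇓ i → A ⊢ e₂ ⇓ v → Exec A o (set k e₁ e₂) (A ⟦ k , i ≔ v ⟧) o false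
  exec-set {v = v} k p v≤ e₁⇓ e₂⇓ = execs λ {mem} rep →
    _ , trans (>>=-just _ (eval≡ e₁⇓ rep))
              (trans (>>=-just _ (eval≡ e₂⇓ rep)) (>>=-just _ (write-< mem k v≤ p))) ,
    Represents-upd v rep p

  exec-inc : ∀ {A o e i} k → i < len sh k n → suc (A k i) ≤ suc n →
             A ⊢ e ⇓ i → Exec A o (inc k e) (A ⟦ k , i ≔ suc (A k i) ⟧) o false
  exec-inc {A} {i = i} k p ≤1+n e⇓ = execs λ {mem} rep →
    upd mem k (fromℕ< p) (+ (A k i + 1)) , trans (>>=-just _ (eval≡ e⇓ rep))
          (trans (>>=-just _ (eval≡ (rd⇓ k p (lit⇓ i)) rep))
                 (>>=-just _ (write-< mem k (subst (_≤ suc n) (+-comm 1 (A k i)) ≤1+n) p))) ,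
    subst (λ v → Represents (A ⟦ k , i ≔ v ⟧) (upd mem k (fromℕ< p) (+ (A k i + 1))))
          (+-comm (A k i) 1) (Represents-upd _ rep p)

  exec-out : ∀ {A o} b → Exec A o (out b) A (o ++ [ b ]) false
  exec-out b = execs λ rep → _ , refl , rep

  eq?-≡ : ∀ x → eq? (+ x) (+ x) ≡ true
  eq?-≡ x with + x ℤ.≟ + x
  ... | yes _  = refl
  ... | no x≢x = contradiction refl x≢x

  eq?-≢ : ∀ {x y} → x ≢ y → eq? (+ x) (+ y) ≡ false
  eq?-≢ {x} {y} x≢y with + x ℤ.≟ + y
  ... | yes x≡y = contradiction (cong ℤ.∣_∣ x≡y) x≢y
  ... | no _    = refl

  less?-< : ∀ {x y} → x < y → less? (+ x) (+ y) ≡ true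
  less?-< {x} {y} x<y with + x ℤ.<? + y
  ... | yes _  = refl
  ... | no x≮y = contradiction (ℤ.+<+ x<y) x≮y

  less?-≥ : ∀ {x y} → y ≤ x → less? (+ x) (+ y) ≡ false
  less?-≥ {x} {y} y≤x with + x ℤ.<? + y
  ... | yes (ℤ.+<+ x<y) = contradiction y≤x (<⇒≱ x<y)
  ... | no _            = refl

  %2-odd : ∀ x → x % 2 ≡ (if odd x then 1 else 0)
  %2-odd zero          = refl
  %2-odd (suc zero)    = refl
  %2-odd (suc (suc x)) = trans (%2-odd x) (cong (if_then 1 else 0) (sym (not-involutive (odd x))))

  even?-odd : ∀ x → even? (+ x) ≡ not (odd x)
  even?-odd x with x % 2 ≟ 0 | %2-odd x
  ... | yes x%2≡0 | x%2≡ with odd x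
  ...   | false = refl
  ...   | true  = contradiction (trans (sym x%2≡) x%2≡0) 1+n≢0
  even?-odd x | no x%2≢0 | x%2≡ with odd x
  ...   | false = contradiction x%2≡ x%2≢0
  ...   | true  = refl

  exec-via : ∀ {A o s ss B o′ h} →
             (∀ {mem} → Represents A mem → exec s (config mem o false) ≡ execList ss (config mem o false)) →
             Runs A o ss B o′ h → Exec A o s B o′ h
  exec-via s≡ss ss⇒ = execs λ rep →
    let mem′ , ex , rep′ = execList⇒ ss⇒ rep in mem′ , trans (s≡ss rep) ex , rep′

  exec-ifEq-yes : ∀ {A o a b t e x B o′ h} → A ⊢ a ⇓ x → A ⊢ b ⇓ x →
                  Runs A o t B o′ h → Exec A o (ifEq a b t e) B o′ h
  exec-ifEq-yes {x = x} a⇓ b⇓ = exec-via λ rep →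
    trans (>>=-just _ (eval≡ a⇓ rep)) (trans (>>=-just _ (eval≡ b⇓ rep)) (if-cong (eq?-≡ x)))

  exec-ifEq-no : ∀ {A o a b t e x y B o′ h} → A ⊢ a ⇓ x → A ⊢ b ⇓ y → x ≢ y →
                 Runs A o e B o′ h → Exec A o (ifEq a b t e) B o′ h
  exec-ifEq-no a⇓ b⇓ x≢y = exec-via λ rep →
    trans (>>=-just _ (eval≡ a⇓ rep)) (trans (>>=-just _ (eval≡ b⇓ rep)) (if-cong (eq?-≢ x≢y)))

  exec-ifLess-yes : ∀ {A o a b t e x y B o′ h} → A ⊢ a ⇓ x → A ⊢ b ⇓ y → x < y →
                    Runs A o t B o′ h → Exec A o (ifLess a b t e) B o′ h
  exec-ifLess-yes a⇓ b⇓ x<y = exec-via λ rep →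
    trans (>>=-just _ (eval≡ a⇓ rep)) (trans (>>=-just _ (eval≡ b⇓ rep)) (if-cong (less?-< x<y)))

  exec-ifLess-no : ∀ {A o a b t e x y B o′ h} → A ⊢ a ⇓ x → A ⊢ b ⇓ y → y ≤ x →
                   Runs A o e B o′ h → Exec A o (ifLess a b t e) B o′ h
  exec-ifLess-no a⇓ b⇓ y≤x = exec-via λ rep →
    trans (>>=-just _ (eval≡ a⇓ rep)) (trans (>>=-just _ (eval≡ b⇓ rep)) (if-cong (less?-≥ y≤x)))

  exec-ifEven-even : ∀ {A o a t e x B o′ h} → A ⊢ a ⇓ x → odd x ≡ false →
                     Runs A o t B o′ h → Exec A o (ifEven a t e) B o′ h
  exec-ifEven-even {x = x} a⇓ even = exec-via λ rep →
    trans (>>=-just _ (eval≡ a⇓ rep)) (if-cong (trans (even?-odd x) (cong not even)))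

  exec-ifEven-odd : ∀ {A o a t e x B o′ h} → A ⊢ a ⇓ x → odd x ≡ true →
                    Runs A o e B o′ h → Exec A o (ifEven a t e) B o′ h
  exec-ifEven-odd {x = x} a⇓ odd′ = exec-via λ rep →
    trans (>>=-just _ (eval≡ a⇓ rep)) (if-cong (trans (even?-odd x) (cong not odd′)))

  runs-[] : ∀ {A o} → Runs A o [] A o false
  runs-[] = runs λ rep → _ , refl , rep

  runs-∷ : ∀ {A o s ss B o′ C o″ h} → Exec A o s B o′ false → Runs B o′ ss C o″ h →
           Runs A o (s ∷ ss) C o″ h
  runs-∷ {ss = ss} s⇒ ss⇒ = runs λ rep →
    let _ , ex , rep′ = exec⇒ s⇒ rep
        mem″ , ex′ , rep″ = execList⇒ ss⇒ rep′
    in mem″ , trans (cong (_>>= execList ss) ex) ex′ , rep″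

  runs-last : ∀ {A o s B o′ h} → Exec A o s B o′ h → Runs A o (s ∷ []) B o′ h
  runs-last s⇒ = runs λ rep →
    let mem′ , ex , rep′ = exec⇒ s⇒ rep in mem′ , cong (_>>= execList []) ex , rep′

  exec-halt : ∀ {A o} → Exec A o halt A o true
  exec-halt = execs λ rep → _ , refl , rep

  Exec-resp : ∀ {A o s B C o′ h} → B ≋ C → Exec A o s B o′ h → Exec A o s C o′ h
  Exec-resp B≋C s⇒ = execs λ rep →
    let mem′ , ex , rep′ = exec⇒ s⇒ rep in mem′ , ex , Represents-resp B≋C rep′

  Runs-resp : ∀ {A o ss B C o′ h} → B ≋ C → Runs A o ss B o′ h → Runs A o ss C o′ h
  Runs-resp B≋C ss⇒ = runs λ rep →
    let mem′ , ex , rep′ = execList⇒ ss⇒ rep in mem′ , ex , Represents-resp B≋C rep′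

  run-stop : ∀ P mem {mem′ o} fuel → step P mem ≡ just (config mem′ o true) →
             run sh n (suc fuel) P mem ≡ just ([] , o)
  run-stop P mem fuel stops rewrite stops = refl

  run-continue : ∀ P mem {mem′ o mids final} fuel → step P mem ≡ just (config mem′ o false) →
                 run sh n fuel P mem′ ≡ just (mids , final) →
                 run sh n (suc fuel) P mem ≡ just (o ∷ mids , final)
  run-continue P mem fuel continues rest rewrite continues | rest = refl

-- The loopless program and its correctness

shape : Shape
shape = record { K = 5 ; mult = λ _ → 1 ; add = λ _ → 2 }

pattern F = Fin.zero
pattern C = Fin.suc Fin.zero
pattern B = Fin.suc (Fin.suc Fin.zero)
pattern N = Fin.suc (Fin.suc (Fin.suc Fin.zero))
pattern R = Fin.suc (Fin.suc (Fin.suc (Fin.suc Fin.zero)))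

level level+1 lastLevel : Expr 5
level     = rd R (lit (+ 0))
level+1   = rd N level
lastLevel = rd B (lit (+ 0))

ownBit : Bool → Stmt 5
ownBit p = ifLess (rd C level) (lit (+ 2)) (out p ∷ []) (out (not p) ∷ [])

emitBit : Stmt 5
emitBit = ifEven level (ownBit false ∷ []) (ownBit true ∷ [])

carryStmts : List (Stmt 5)
carryStmts = set C level (lit (+ 0)) ∷ set F level (rd F level+1) ∷ set F level+1 level+1 ∷ []

advanceStmts : List (Stmt 5)
advanceStmts = emitBit ∷ inc C level ∷ ifEq (rd C level) (rd B level) carryStmts [] ∷ []

finishStmts : List (Stmt 5)
finishStmts = ifEven lastLevel (out true ∷ []) (out false ∷ []) ∷ halt ∷ []

dispatch : Stmt 5
dispatch = ifEq level lastLevel finishStmts advanceStmts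

program : Program shape
program = set R (lit (+ 0)) (rd F (lit (+ 0))) ∷ set F (lit (+ 0)) (lit (+ 0)) ∷ dispatch ∷ []

module Simulation (n : ℕ) where
  open Levels n
  open Hoare shape n

  -- F holds the focus pointers, C the counters and B their bounds (B 0 is the last level); N k is k + 1, capped so
  -- that every entry stays at most n + 1; R 0 keeps the level of the current step, since F 0 is reset at its start.
  arrays : State → (ℕ → ℕ) → Arrays
  arrays σ r F = focus σ
  arrays σ r C = counter σ
  arrays σ r B = bound
  arrays σ r N = λ k → suc (k ⊓ n)
  arrays σ r R = r

  arrays-resp : ∀ {σ τ} r → σ ≈ τ → arrays σ r ≋ arrays τ r
  arrays-resp r (f≗ , c≗) F = f≗
  arrays-resp r (f≗ , c≗) C = c≗
  arrays-resp r (f≗ , c≗) B = λ _ → refl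
  arrays-resp r (f≗ , c≗) N = λ _ → refl
  arrays-resp r (f≗ , c≗) R = λ _ → refl

  Simulates : State → Memory shape n → Set
  Simulates σ mem = ∃[ r ] Represents (arrays σ r) mem

  len≡ : ∀ k → len shape k n ≡ suc (suc n)
  len≡ k = trans (cong (_+ 2) (*-identityˡ n)) (+-comm n 2)

  index< : ∀ {i} k → i ≤ suc n → i < len shape k n
  index< {i} k i≤ = subst (i <_) (sym (len≡ k)) (s≤s i≤)

  index≤ : ∀ {i} k → i < len shape k n → i ≤ suc n
  index≤ {i} k i< = s≤s⁻¹ (subst (i <_) (len≡ k) i<)

  set-focus : ∀ {σ r o e₁ e₂ i v} → i ≤ suc n → v ≤ suc n →
              arrays σ r ⊢ e₁ ⇓ i → arrays σ r ⊢ e₂ ⇓ v →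
              Exec (arrays σ r) o (set F e₁ e₂) (arrays ⟨ focus σ [ i ≔ v ] , counter σ ⟩ r) o false
  set-focus i≤ v≤ e₁⇓ e₂⇓ =
    Exec-resp (λ { F _ → refl ; C _ → refl ; B _ → refl ; N _ → refl ; R _ → refl })
              (exec-set F (index< F i≤) v≤ e₁⇓ e₂⇓)

  set-counter : ∀ {σ r o e₁ e₂ i v} → i ≤ suc n → v ≤ suc n →
                arrays σ r ⊢ e₁ ⇓ i → arrays σ r ⊢ e₂ ⇓ v →
                Exec (arrays σ r) o (set C e₁ e₂) (arrays ⟨ focus σ , counter σ [ i ≔ v ] ⟩ r) o false
  set-counter i≤ v≤ e₁⇓ e₂⇓ =
    Exec-resp (λ { F _ → refl ; C _ → refl ; B _ → refl ; N _ → refl ; R _ → refl })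
              (exec-set C (index< C i≤) v≤ e₁⇓ e₂⇓)

  set-register : ∀ {σ r o e₁ e₂ i v} → i ≤ suc n → v ≤ suc n →
                 arrays σ r ⊢ e₁ ⇓ i → arrays σ r ⊢ e₂ ⇓ v →
                 Exec (arrays σ r) o (set R e₁ e₂) (arrays σ (r [ i ≔ v ])) o false
  set-register i≤ v≤ e₁⇓ e₂⇓ =
    Exec-resp (λ { F _ → refl ; C _ → refl ; B _ → refl ; N _ → refl ; R _ → refl })
              (exec-set R (index< R i≤) v≤ e₁⇓ e₂⇓)

  inc-counter : ∀ {σ r o e i} → i ≤ suc n → counter σ i ≤ n → arrays σ r ⊢ e ⇓ i →
                Exec (arrays σ r) o (inc C e)
                     (arrays ⟨ focus σ , counter σ [ i ≔ suc (counter σ i) ] ⟩ r) o false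
  inc-counter i≤ c≤ e⇓ =
    Exec-resp (λ { F _ → refl ; C _ → refl ; B _ → refl ; N _ → refl ; R _ → refl })
              (exec-inc C (index< C i≤) (s≤s c≤) e⇓)

  level⇓ : ∀ {σ r j} → r 0 ≡ j → arrays σ r ⊢ level ⇓ j
  level⇓ r0≡j = ⇓-≡ (rd⇓ R (index< R z≤n) (lit⇓ 0)) r0≡j

  lastLevel⇓ : ∀ {σ r} → arrays σ r ⊢ lastLevel ⇓ last
  lastLevel⇓ = rd⇓ B (index< B z≤n) (lit⇓ 0)

  below : ∀ {A o p c} → A ⊢ rd C level ⇓ c → c < 2 → Exec A o (ownBit p) A (o ++ [ p ]) false
  below c⇓ c<2 = exec-ifLess-yes c⇓ (lit⇓ 2) c<2 (runs-last (exec-out _))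

  above : ∀ {A o p c} → A ⊢ rd C level ⇓ suc (suc c) → Exec A o (ownBit p) A (o ++ [ not p ]) false
  above c⇓ = exec-ifLess-no c⇓ (lit⇓ 2) (s≤s (s≤s z≤n)) (runs-last (exec-out _))

  ownBit-exec : ∀ {A o} p {c} → A ⊢ rd C level ⇓ c →
                Exec A o (ownBit p) A (o ++ [ p xor (2 ≤ᵇ c) ]) false
  ownBit-exec false {0}           c⇓ = below c⇓ (s≤s z≤n)
  ownBit-exec true  {0}           c⇓ = below c⇓ (s≤s z≤n)
  ownBit-exec false {1}           c⇓ = below c⇓ (s≤s (s≤s z≤n))
  ownBit-exec true  {1}           c⇓ = below c⇓ (s≤s (s≤s z≤n))
  ownBit-exec false {suc (suc _)} c⇓ = above c⇓
  ownBit-exec true  {suc (suc _)} c⇓ = above c⇓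

  emitBit-exec : ∀ {A o j c} → A ⊢ level ⇓ j → A ⊢ rd C level ⇓ c →
                 Exec A o emitBit A (o ++ [ odd j xor (2 ≤ᵇ c) ]) false
  emitBit-exec {j = j} j⇓ c⇓ with odd j in odd≡
  ... | false = exec-ifEven-even j⇓ odd≡ (runs-last (ownBit-exec false c⇓))
  ... | true  = exec-ifEven-odd j⇓ odd≡ (runs-last (ownBit-exec true c⇓))

  finish-runs : ∀ {A o} → A ⊢ lastLevel ⇓ last → Runs A o finishStmts A (o ++ [ not (odd last) ]) true
  finish-runs L⇓ with odd last in odd≡
  ... | false = runs-∷ (exec-ifEven-even L⇓ odd≡ (runs-last (exec-out true))) (runs-last exec-halt)
  ... | true  = runs-∷ (exec-ifEven-odd L⇓ odd≡ (runs-last (exec-out false))) (runs-last exec-halt)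

  last≤n : last ≤ n
  last≤n = m∸n≤m n 1

  carry-runs : ∀ {ρ r o j} → r 0 ≡ j → j < last → focus ρ (suc j) ≤ last →
               Runs (arrays ρ r) o carryStmts (arrays (carry j ρ) r) o false
  carry-runs {ρ} {r} {j = j} r0≡j j<L f≤L =
    runs-∷ (set-counter j≤ z≤n (level⇓ r0≡j) (lit⇓ 0))
      (runs-∷ (set-focus j≤ (≤-trans f≤L L≤1+n) (level⇓ r0≡j) (rd⇓ F (index< F 1+j≤) level+1⇓))
        (runs-last (set-focus 1+j≤ 1+j≤ level+1⇓ level+1⇓)))
    where
    L≤1+n : last ≤ suc n
    L≤1+n = m≤n⇒m≤1+n last≤n
    1+j≤ : suc j ≤ suc n
    1+j≤ = ≤-trans j<L L≤1+n
    j≤n : j ≤ n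
    j≤n = <⇒≤ (≤-trans j<L last≤n)
    j≤ : j ≤ suc n
    j≤ = m≤n⇒m≤1+n j≤n
    level+1⇓ : ∀ {σ} → arrays σ r ⊢ level+1 ⇓ suc j
    level+1⇓ = ⇓-≡ (rd⇓ N (index< N j≤) (level⇓ r0≡j)) (cong suc (m≤n⇒m⊓n≡m j≤n))

  advance-runs : ∀ {ρ r o j} → r 0 ≡ j → j < last → InRange ρ →
                 Runs (arrays ρ r) o advanceStmts (arrays (advance j ρ) r) (o ++ [ bit j ρ ]) false
  advance-runs {ρ} {r} {o} {j} r0≡j j<L (fr , cr) =
    runs-∷ (emitBit-exec j⇓ (rd⇓ C (index< C j≤) j⇓))
      (runs-∷ (inc-counter j≤ c≤n j⇓) (runs-last branch))
    where
    j⇓ : ∀ {σ} → arrays σ r ⊢ level ⇓ j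
    j⇓ = level⇓ r0≡j
    j≤ : j ≤ suc n
    j≤ = m≤n⇒m≤1+n (<⇒≤ (≤-trans j<L last≤n))
    c≤n : counter ρ j ≤ n
    c≤n = <⇒≤ (≤-trans (cr j j<L) (m∸n≤m n (suc j)))
    ρ′ : State
    ρ′ = ⟨ focus ρ , counter ρ [ j ≔ suc (counter ρ j) ] ⟩
    c⇓ : arrays ρ′ r ⊢ rd C level ⇓ suc (counter ρ j)
    c⇓ = ⇓-≡ (rd⇓ C (index< C j≤) j⇓) (update-updates (counter ρ) j _)
    branch : Exec (arrays ρ′ r) (o ++ [ bit j ρ ]) (ifEq (rd C level) (rd B level) carryStmts [])
                  (arrays (advance j ρ) r) (o ++ [ bit j ρ ]) false
    branch with suc (counter ρ j) ≟ bound j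
    ... | yes wraps =
      exec-ifEq-yes c⇓ (⇓-≡ (rd⇓ B (index< B j≤) j⇓) (sym wraps))
        (Runs-resp (arrays-resp r ((λ _ → refl) , update-update (counter ρ) j _ 0))
                   (carry-runs r0≡j j<L (fr (suc j) j<L)))
    ... | no ¬wraps = exec-ifEq-no c⇓ (rd⇓ B (index< B j≤) j⇓) ¬wraps runs-[]

  prefix-runs : ∀ {σ r A o h} → focus σ 0 ≤ last →
                Runs (arrays (reset 0 σ) (r [ 0 ≔ focus σ 0 ])) [] (dispatch ∷ []) A o h →
                Runs (arrays σ r) [] program A o h
  prefix-runs f0≤L rest =
    runs-∷ (set-register z≤n (m≤n⇒m≤1+n (≤-trans f0≤L last≤n)) (lit⇓ 0)
                         (rd⇓ F (index< F z≤n) (lit⇓ 0)))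
      (runs-∷ (set-focus z≤n z≤n (lit⇓ 0) (lit⇓ 0)) rest)

  program-halts : ∀ {σ r} → focus σ 0 ≡ last →
                  Runs (arrays σ r) [] program (arrays (reset 0 σ) (r [ 0 ≔ focus σ 0 ])) [ finalBit ] true
  program-halts {r = r} f0≡L = prefix-runs (≤-reflexive f0≡L)
    (runs-last (exec-ifEq-yes (level⇓ (trans (update-updates r 0 _) f0≡L)) lastLevel⇓
                              (finish-runs lastLevel⇓)))

  program-advances : ∀ {σ r} → InRange σ → focus σ 0 ≢ last →
                     Runs (arrays σ r) [] program (arrays (advance (focus σ 0) (reset 0 σ)) (r [ 0 ≔ focus σ 0 ]))
                          [ bit (focus σ 0) σ ] false
  program-advances {σ} {r} inR f0≢L = prefix-runs f0≤L
    (runs-last (exec-ifEq-no (level⇓ (update-updates r 0 _)) lastLevel⇓ f0≢L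
      (advance-runs (update-updates r 0 _) (≤∧≢⇒< f0≤L f0≢L) (InRange-reset σ inR))))
    where
    f0≤L : focus σ 0 ≤ last
    f0≤L = proj₁ inR 0 z≤n

  Produces : ℕ → Memory shape n → List Bool → Set
  Produces fuel mem bs =
    ∃[ mids ] ∃[ final ] (run shape n fuel program mem ≡ just (mids , final)) ×
                         All NonEmpty mids × (concat mids ++ final ≡ bs)

  emits⇒produces : ∀ {σ bs mem} → Emits 0 σ bs → InRange σ → Simulates σ mem →
                   Produces (length bs) mem bs
  emits⇒produces {mem = mem} (halts f0≡L) _ (r , rep) =
    let _ , stops , _ = execList⇒ (program-halts f0≡L) rep
    in [] , [ finalBit ] , run-stop program mem 0 stops , [] , refl
  emits⇒produces {σ} {_ ∷ bs} {mem} (steps refl f0≢L refl adv e) inR (r , rep) =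
    let _ , continues , rep′ = execList⇒ (program-advances inR f0≢L) rep
        inR′ = InRange-resp adv
                 (InRange-advance _ _ (≤∧≢⇒< (proj₁ inR 0 z≤n) f0≢L) (InRange-reset σ inR))
        mids , final , run≡ , nonEmpties , concat≡ =
          emits⇒produces e inR′ (_ , Represents-resp (arrays-resp _ adv) rep′)
    in [ bit (focus σ 0) σ ] ∷ mids , final , run-continue program mem (length bs) continues run≡ ,
       nonEmpty _ [] ∷ nonEmpties , cong (bit (focus σ 0) σ ∷_) concat≡

  initialMemory : Memory shape n
  initialMemory k = tabulate (λ i → + arrays initial (λ _ → 0) k (toℕ i))

  initial-simulated : Simulates initial initialMemory
  initial-simulated = (λ _ → 0) , represents λ k i → lookup∘tabulate _ i

  initial-inRange : InRange initial
  initial-inRange = (λ _ k≤L → k≤L) , λ k k<L → subst (0 <_) (∸-+-assoc n 1 k) (m<n⇒0<n∸m k<L)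

  initialMemory-bounded : Bounded shape n initialMemory
  initialMemory-bounded k i rewrite lookup∘tabulate (λ i → + arrays initial (λ _ → 0) k (toℕ i)) i =
    entry≤ k (index≤ k (toℕ<n i))
    where
    entry≤ : ∀ k {x} → x ≤ suc n → arrays initial (λ _ → 0) k x ≤ suc n
    entry≤ F x≤ = x≤
    entry≤ C _  = z≤n
    entry≤ B {x} _ = m≤n⇒m≤1+n (m∸n≤m n (suc x))
    entry≤ N {x} _ = s≤s (m⊓n≤n x n)
    entry≤ R _  = z≤n

mainTheorem2 : Σ Shape λ sh →
    Σ (Program sh) λ P →
    Σ ((n : ℕ) → Memory sh n) λ init →
    (n : ℕ) → 2 ≤ n →
    Bounded sh n (init n) ×
    Σ ℕ λ fuel →
    Σ (List (List Bool)) λ mids →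
    Σ (List Bool) λ last →
    (run sh n fuel P (init n) ≡ just (mids , last)) ×
    All NonEmpty mids ×
    (concat mids ++ last ≡ S n)
mainTheorem2 = shape , program , Simulation.initialMemory , λ n 2≤n →
  let open Simulation n in
  initialMemory-bounded , length (S n) ,
  emits⇒produces (Levels.emits-S n 2≤n) initial-inRange initial-simulated
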